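{- (i) Every chordal graph $G$ satisfies $\omega_1(G)\le \chi_1(G)\le \left\lceil \frac{\chi(G)}{2}\right\rceil$. (ii) For every integer $k\ge 2$ there exists an interval graph $G_k$ with $\omega(G_k)=\chi(G_k)=k$ and $\omega_1(G_k)=\chi_1(G_k)=\left\lceil \frac{k}{2}\right\rceil$.
   Context: All graphs are finite and simple. A 1-selection of a graph $G=(V,E)$ is a map $f$ assigning to each vertex $v$ a set $f(v)$ of at most one edge incident with $v$. The 1-removed subgraph $G_f$ has vertex set $V$ and edge set $E\setminus\bigcup_{v\in V}f(v)$. The robust chromatic number is $\chi_1(G)=\min_f\chi(G_f)$ and the robust clique number is $\omega_1(G)=\min_f\omega(G_f)$, minima over all 1-selections $f$ of $G$. A graph is chordal if it has no induced cycle of length greater than 3; an interval graph is the intersection graph of a family of intervals of the real line. -}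

module Defs where

open import Data.Nat using (ℕ; zero; suc; _≤_; _+_; ⌈_/2⌉)
open import Data.Fin using (Fin; toℕ)
open import Data.Maybe using (Maybe; just; nothing)
import Data.Maybe as Maybe
open import Data.Product using (Σ; ∃; _×_; _,_; proj₁; proj₂)
open import Data.Sum using (_⊎_)
open import Relation.Nullary using (¬_)
open import Relation.Binary.PropositionalEquality using (_≡_; _≢_)
open import Function.Definitions using (Injective)

_⇔′_ : Set → Set → Set
A ⇔′ B = (A → B) × (B → A)

record Graph : Set₁ where
  field
    n      : ℕ
    Adj    : Fin n → Fin n → Set
    sym    : ∀ {u v} → Adj u v → Adj v u
    irrefl : ∀ {v} → ¬ Adj v v
open Graph public

Colorable : Graph → ℕ → Set
Colorable G k = Σ (Fin (n G) → Fin k) λ c → ∀ u v → Adj G u v → c u ≢ c v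

IsChromaticNumber : Graph → ℕ → Set
IsChromaticNumber G k = Colorable G k × (∀ m → Colorable G m → k ≤ m)

HasClique : Graph → ℕ → Set
HasClique G k = Σ (Fin k → Fin (n G)) λ h →
  Injective _≡_ _≡_ h × (∀ i j → i ≢ j → Adj G (h i) (h j))

IsCliqueNumber : Graph → ℕ → Set
IsCliqueNumber G k = HasClique G k × (∀ m → HasClique G m → m ≤ k)

OneSelection : Graph → Set
OneSelection G = (v : Fin (n G)) → Maybe (Σ (Fin (n G)) (Adj G v))

selTarget : (G : Graph) → OneSelection G → Fin (n G) → Maybe (Fin (n G))
selTarget G f v = Maybe.map proj₁ (f v)

removed : (G : Graph) → OneSelection G → Graph
removed G f = record
  { n      = n G
  ; Adj    = λ u v → Adj G u v × (selTarget G f u ≢ just v) × (selTarget G f v ≢ just u)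
  ; sym    = λ { (a , p , q) → Graph.sym G a , q , p }
  ; irrefl = λ { (a , _ , _) → Graph.irrefl G a }
  }

IsRobustChromaticNumber : Graph → ℕ → Set
IsRobustChromaticNumber G k =
  (Σ (OneSelection G) λ f → IsChromaticNumber (removed G f) k) ×
  (∀ f m → IsChromaticNumber (removed G f) m → k ≤ m)

IsRobustCliqueNumber : Graph → ℕ → Set
IsRobustCliqueNumber G k =
  (Σ (OneSelection G) λ f → IsCliqueNumber (removed G f) k) ×
  (∀ f m → IsCliqueNumber (removed G f) m → k ≤ m)

CycleAdj : (m : ℕ) → Fin m → Fin m → Set
CycleAdj m i j =
  toℕ j ≡ suc (toℕ i) ⊎ toℕ i ≡ suc (toℕ j) ⊎
  (toℕ i ≡ 0 × suc (toℕ j) ≡ m) ⊎ (toℕ j ≡ 0 × suc (toℕ i) ≡ m)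

HasInducedCycle : Graph → ℕ → Set
HasInducedCycle G m = Σ (Fin m → Fin (n G)) λ c →
  Injective _≡_ _≡_ c × (∀ i j → Adj G (c i) (c j) ⇔′ CycleAdj m i j)

Chordal : Graph → Set
Chordal G = ∀ m → 4 ≤ m → ¬ HasInducedCycle G m

-- intersection graph of closed intervals [l v , r v] (natural-number endpoints);
-- for finite graphs this is equivalent to any real-interval representation
IsIntervalGraph : Graph → Set
IsIntervalGraph G = Σ (Fin (n G) → ℕ) λ l → Σ (Fin (n G) → ℕ) λ r →
  (∀ v → l v ≤ r v) ×
  (∀ u v → u ≢ v → Adj G u v ⇔′ (l u ≤ r v × l v ≤ r u))

-- (i) ω₁ ≤ χ₁ holds in every graph, since an optimal colouring of an optimal G_f bounds the
-- clique number of G_f. For χ₁ ≤ ⌈χ/2⌉, merge the colour classes 2i and 2i+1 of an optimal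
-- colouring. The edges inside a merged class form a forest: a cycle among them would give either
-- a triangle using three colours from one pair, or an induced cycle of length at least 4 in the
-- chordal graph. Peeling off leaves, every vertex can select the edge to its parent in this forest,
-- and then the merged classes properly colour G_f.
-- (ii) G_k is the intersection graph of the dyadic intervals [j 2^h, (j+1) 2^h - 1], h < k. It is
-- coloured by level, and the intervals containing 0 form a k-clique. If every interval selects its
-- parent, exactly the edges between consecutive levels disappear, so ⌊level/2⌋ colours G_f with
-- ⌈k/2⌉ colours. Conversely, for any 1-selection, descend from the root always into a child not
-- containing the interval the current vertex selects: the resulting chain of k nested intervals is a
-- clique of G whose removed edges all point upwards, so it splits into two cliques of G_f.
-- Adjacency is not decidable, so the extremal arguments run in the double-negation monad; the
-- conclusions are inequalities between naturals and hence stable.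

{-# OPTIONS --safe #-}
module Submission where

open import Defs hiding (sym)
open import Level using (0ℓ)
open import Data.Nat using (ℕ; zero; suc; _≤_; _<_; _+_; _*_; ⌈_/2⌉; ⌊_/2⌋; z≤n; s≤s; s≤s⁻¹; _≤?_; _<?_)
open import Data.Nat.Properties
open import Data.Nat.Induction using (<-rec)
open import Data.Nat.Tactic.RingSolver using (solve-∀)
open import Data.Fin as Fin using (Fin; toℕ; fromℕ<; inject≤; combine; quotient; remainder)
open import Data.Fin.Properties using (toℕ-injective; toℕ-fromℕ<; toℕ<n; injective⇒≤; inject≤-injective; remQuot-combine; combine-remQuot)
open import Data.Product using (Σ; _×_; _,_; proj₁; proj₂)
open import Data.Sum as Sum using (_⊎_; inj₁; inj₂; [_,_]′)
open import Data.Empty using (⊥; ⊥-elim)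
open import Data.Maybe using (Maybe; just; nothing)
open import Data.Maybe.Properties using (just-injective)
open import Data.List using (List; []; _∷_; _++_; length; lookup; filter; allFin)
open import Data.List.Properties using (length-++; ++-assoc; filter-notAll)
open import Data.List.Relation.Unary.Any as Any using (Any; here; there)
open import Data.List.Relation.Unary.All as All using (All; []; _∷_)
open import Data.List.Relation.Unary.All.Properties using (++⁻ˡ; ¬Any⇒All¬)
open import Data.List.Relation.Unary.AllPairs as AllPairs using (AllPairs; []; _∷_)
open import Data.List.Membership.Propositional using (_∈_; _∉_)
open import Data.List.Relation.Binary.Subset.Propositional using (_⊆_)
open import Data.List.Membership.Propositional.Properties using (∈-lookup; ∈-++⁺ˡ; ∈-filter⁺; ∈-allFin)
open import Effect.Monad using (RawMonad)
open import Relation.Nullary using (¬_; ¬?; Dec; yes; no)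
open import Relation.Nullary.Negation using (DoubleNegation; ¬¬-Monad)
open import Relation.Nullary.Decidable using (_×-dec_; ¬¬-excluded-middle; decidable-stable)
open import Relation.Binary.PropositionalEquality
open import Relation.Binary.Definitions using (tri<; tri≈; tri>)
open import Function using (_∘_; case_of_)

open RawMonad (¬¬-Monad {a = 0ℓ}) using (pure; _>>=_)

-- Halving colours

⌊n/2⌋+⌊n/2⌋≤n : ∀ n → ⌊ n /2⌋ + ⌊ n /2⌋ ≤ n
⌊n/2⌋+⌊n/2⌋≤n zero = z≤n
⌊n/2⌋+⌊n/2⌋≤n (suc zero) = z≤n
⌊n/2⌋+⌊n/2⌋≤n (suc (suc n)) rewrite +-suc ⌊ n /2⌋ ⌊ n /2⌋ = s≤s (s≤s (⌊n/2⌋+⌊n/2⌋≤n n))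

n≤1+⌊n/2⌋+⌊n/2⌋ : ∀ n → n ≤ suc (⌊ n /2⌋ + ⌊ n /2⌋)
n≤1+⌊n/2⌋+⌊n/2⌋ zero = z≤n
n≤1+⌊n/2⌋+⌊n/2⌋ (suc zero) = s≤s z≤n
n≤1+⌊n/2⌋+⌊n/2⌋ (suc (suc n)) rewrite +-suc ⌊ n /2⌋ ⌊ n /2⌋ = s≤s (s≤s (n≤1+⌊n/2⌋+⌊n/2⌋ n))

⌈m+n/2⌉≤m⊎⌈m+n/2⌉≤n : ∀ m n → ⌈ m + n /2⌉ ≤ m ⊎ ⌈ m + n /2⌉ ≤ n
⌈m+n/2⌉≤m⊎⌈m+n/2⌉≤n m n with ⌈ m + n /2⌉ ≤? m | ⌈ m + n /2⌉ ≤? n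
... | yes h≤m | _ = inj₁ h≤m
... | no _ | yes h≤n = inj₂ h≤n
... | no h≰m | no h≰n = ⊥-elim (<-irrefl refl (≤-trans 2+m+n≤h+h (⌊n/2⌋+⌊n/2⌋≤n (suc (m + n)))))
  where
  2+m+n≤h+h : suc (suc (m + n)) ≤ ⌈ m + n /2⌉ + ⌈ m + n /2⌉
  2+m+n≤h+h = subst (_≤ ⌈ m + n /2⌉ + ⌈ m + n /2⌉) (+-suc (suc m) n) (+-mono-≤ (≰⇒> h≰m) (≰⇒> h≰n))

⌊m/2⌋≡⌊n/2⌋⇒m≡n⊎m≡1+n⊎n≡1+m : ∀ m n → ⌊ m /2⌋ ≡ ⌊ n /2⌋ → m ≡ n ⊎ m ≡ suc n ⊎ n ≡ suc m
⌊m/2⌋≡⌊n/2⌋⇒m≡n⊎m≡1+n⊎n≡1+m zero zero _ = inj₁ refl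
⌊m/2⌋≡⌊n/2⌋⇒m≡n⊎m≡1+n⊎n≡1+m zero (suc zero) _ = inj₂ (inj₂ refl)
⌊m/2⌋≡⌊n/2⌋⇒m≡n⊎m≡1+n⊎n≡1+m (suc zero) zero _ = inj₂ (inj₁ refl)
⌊m/2⌋≡⌊n/2⌋⇒m≡n⊎m≡1+n⊎n≡1+m (suc zero) (suc zero) _ = inj₁ refl
⌊m/2⌋≡⌊n/2⌋⇒m≡n⊎m≡1+n⊎n≡1+m (suc (suc m)) (suc (suc n)) e
  with ⌊m/2⌋≡⌊n/2⌋⇒m≡n⊎m≡1+n⊎n≡1+m m n (suc-injective e)
... | inj₁ refl = inj₁ refl
... | inj₂ (inj₁ refl) = inj₂ (inj₁ refl)
... | inj₂ (inj₂ refl) = inj₂ (inj₂ refl)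

⌊m/2⌋<⌈n/2⌉ : ∀ {m n} → m < n → ⌊ m /2⌋ < ⌈ n /2⌉
⌊m/2⌋<⌈n/2⌉ {zero} {suc n} _ = s≤s z≤n
⌊m/2⌋<⌈n/2⌉ {suc zero} {suc (suc n)} _ = s≤s z≤n
⌊m/2⌋<⌈n/2⌉ {suc zero} {suc zero} (s≤s ())
⌊m/2⌋<⌈n/2⌉ {suc (suc m)} {suc (suc n)} (s≤s (s≤s m<n)) = s≤s (⌊m/2⌋<⌈n/2⌉ m<n)

halve : ∀ {n} → Fin n → Fin ⌈ n /2⌉
halve i = fromℕ< (⌊m/2⌋<⌈n/2⌉ (toℕ<n i))

toℕ-halve : ∀ {n} (i : Fin n) → toℕ (halve i) ≡ ⌊ toℕ i /2⌋
toℕ-halve i = toℕ-fromℕ< (⌊m/2⌋<⌈n/2⌉ (toℕ<n i))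

halve-≡⇒ : ∀ {n} {i j : Fin n} → halve i ≡ halve j → toℕ i ≡ toℕ j ⊎ toℕ i ≡ suc (toℕ j) ⊎ toℕ j ≡ suc (toℕ i)
halve-≡⇒ {i = i} {j} e =
  ⌊m/2⌋≡⌊n/2⌋⇒m≡n⊎m≡1+n⊎n≡1+m (toℕ i) (toℕ j) (trans (sym (toℕ-halve i)) (trans (cong toℕ e) (toℕ-halve j)))

no-three-within-distance-one : ∀ {a b c} → (a ≡ b ⊎ a ≡ suc b ⊎ b ≡ suc a) → (b ≡ c ⊎ b ≡ suc c ⊎ c ≡ suc b) →
  (a ≡ c ⊎ a ≡ suc c ⊎ c ≡ suc a) → a ≢ b → b ≢ c → a ≢ c → ⊥
no-three-within-distance-one (inj₁ a≡b) _ _ a≢b _ _ = a≢b a≡b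
no-three-within-distance-one _ (inj₁ b≡c) _ _ b≢c _ = b≢c b≡c
no-three-within-distance-one _ _ (inj₁ a≡c) _ _ a≢c = a≢c a≡c
no-three-within-distance-one (inj₂ (inj₁ refl)) (inj₂ (inj₁ refl)) (inj₂ (inj₁ ()))
no-three-within-distance-one (inj₂ (inj₁ refl)) (inj₂ (inj₁ refl)) (inj₂ (inj₂ ()))
no-three-within-distance-one (inj₂ (inj₁ refl)) (inj₂ (inj₂ refl)) _ _ _ a≢c = a≢c refl
no-three-within-distance-one (inj₂ (inj₂ refl)) (inj₂ (inj₁ refl)) _ _ _ a≢c = a≢c refl
no-three-within-distance-one (inj₂ (inj₂ refl)) (inj₂ (inj₂ refl)) (inj₂ (inj₁ ()))
no-three-within-distance-one (inj₂ (inj₂ refl)) (inj₂ (inj₂ refl)) (inj₂ (inj₂ ()))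

halve-noThreeDistinct : ∀ {n} {i j k : Fin n} → halve i ≡ halve j → halve j ≡ halve k → i ≢ j → j ≢ k → i ≢ k → ⊥
halve-noThreeDistinct hij hjk i≢j j≢k i≢k =
  no-three-within-distance-one (halve-≡⇒ hij) (halve-≡⇒ hjk) (halve-≡⇒ (trans hij hjk))
    (i≢j ∘ toℕ-injective) (j≢k ∘ toℕ-injective) (i≢k ∘ toℕ-injective)

-- Cliques, colourings and 1-selections

¬¬-greatest : (P : ℕ → Set) → P 0 → ∀ t → (∀ j → P j → j ≤ t) → DoubleNegation (Σ ℕ λ m → P m × ∀ j → P j → j ≤ m)
¬¬-greatest P p0 zero bound = pure (0 , p0 , bound)
¬¬-greatest P p0 (suc t) bound = ¬¬-excluded-middle {A = P (suc t)} >>= λ where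
  (yes pt) → pure (suc t , pt , bound)
  (no ¬pt) → ¬¬-greatest P p0 t (λ j pj → s≤s⁻¹ (≤∧≢⇒< (bound j pj) λ { refl → ¬pt pj }))

¬¬-least : (P : ℕ → Set) → ∀ {n} → P n → DoubleNegation (Σ ℕ λ m → P m × ∀ j → P j → m ≤ j)
¬¬-least P {n} = <-rec (λ n → P n → DoubleNegation (Σ ℕ λ m → P m × ∀ j → P j → m ≤ j)) step n
  where
  step : ∀ n → (∀ {j} → j < n → P j → DoubleNegation (Σ ℕ λ m → P m × ∀ j → P j → m ≤ j)) →
         P n → DoubleNegation (Σ ℕ λ m → P m × ∀ j → P j → m ≤ j)
  step n smaller pn = ¬¬-excluded-middle {A = Σ ℕ λ j → j < n × P j} >>= λ where
    (yes (j , j<n , pj)) → smaller j<n pj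
    (no none) → pure (n , pn , λ j pj → ≮⇒≥ (λ j<n → none (j , j<n , pj)))

Vertex : Graph → Set
Vertex G = Fin (n G)

module _ (G : Graph) where

  AllPairs-lookup : ∀ {L} → AllPairs (Adj G) L → ∀ {i j} → i ≢ j → Adj G (lookup L i) (lookup L j)
  AllPairs-lookup {_ ∷ _} (_ ∷ _) {Fin.zero} {Fin.zero} i≢j = ⊥-elim (i≢j refl)
  AllPairs-lookup {_ ∷ _} (adj ∷ _) {Fin.zero} {Fin.suc j} _ = All.lookup adj (∈-lookup j)
  AllPairs-lookup {_ ∷ _} (adj ∷ _) {Fin.suc i} {Fin.zero} _ = Graph.sym G (All.lookup adj (∈-lookup i))
  AllPairs-lookup {_ ∷ _} (_ ∷ adjs) {Fin.suc i} {Fin.suc j} i≢j = AllPairs-lookup adjs (i≢j ∘ cong Fin.suc)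

  AllPairs⇒HasClique : ∀ {L} → AllPairs (Adj G) L → HasClique G (length L)
  AllPairs⇒HasClique {L} adjs = lookup L , lookup-injective , λ i j → AllPairs-lookup adjs
    where
    lookup-injective : ∀ {i j} → lookup L i ≡ lookup L j → i ≡ j
    lookup-injective {i} {j} e with i Fin.≟ j
    ... | yes i≡j = i≡j
    ... | no i≢j = ⊥-elim (Graph.irrefl G (subst (Adj G (lookup L i)) (sym e) (AllPairs-lookup adjs i≢j)))

  HasClique-≤ : ∀ {k m} → HasClique G m → k ≤ m → HasClique G k
  HasClique-≤ (h , h-inj , adj) k≤m =
    (λ i → h (inject≤ i k≤m)) ,
    (λ e → inject≤-injective k≤m k≤m _ _ (h-inj e)) ,
    (λ i j i≢j → adj _ _ (i≢j ∘ inject≤-injective k≤m k≤m i j))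

  HasClique⇒≤ : ∀ {k m} → HasClique G m → Colorable G k → m ≤ k
  HasClique⇒≤ (h , _ , adj) (c , proper) = injective⇒≤ c∘h-injective
    where
    c∘h-injective : ∀ {i j} → c (h i) ≡ c (h j) → i ≡ j
    c∘h-injective {i} {j} e with i Fin.≟ j
    ... | yes i≡j = i≡j
    ... | no i≢j = ⊥-elim (proper (h i) (h j) (adj i j i≢j) e)

  HasClique-0 : HasClique G 0
  HasClique-0 = (λ ()) , (λ {i} → λ _ → case i of λ ()) , λ ()

  ¬¬-cliqueNumber : DoubleNegation (Σ ℕ (IsCliqueNumber G))
  ¬¬-cliqueNumber = ¬¬-greatest (HasClique G) HasClique-0 (n G) (λ j (_ , h-inj , _) → injective⇒≤ h-inj)

  ¬¬-chromaticNumber≤ : ∀ {k} → Colorable G k → DoubleNegation (Σ ℕ λ m → IsChromaticNumber G m × m ≤ k)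
  ¬¬-chromaticNumber≤ {k} col = ¬¬-least (Colorable G) col >>= λ where
    (m , colm , least) → pure (m , (colm , least) , least k col)

  HasClique∧Colorable⇒IsCliqueNumber : ∀ {k} → HasClique G k → Colorable G k → IsCliqueNumber G k
  HasClique∧Colorable⇒IsCliqueNumber clique col = clique , λ m cliqueₘ → HasClique⇒≤ cliqueₘ col

  HasClique∧Colorable⇒IsChromaticNumber : ∀ {k} → HasClique G k → Colorable G k → IsChromaticNumber G k
  HasClique∧Colorable⇒IsChromaticNumber clique col = col , λ m colₘ → HasClique⇒≤ clique colₘ

Selects : (G : Graph) → OneSelection G → Vertex G → Vertex G → Set
Selects G f u v = selTarget G f u ≡ just v

module _ (G : Graph) where

  SelectsMonochromaticEdges : OneSelection G → ∀ {m} → (Vertex G → Fin m) → Set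
  SelectsMonochromaticEdges f κ = ∀ u v → Adj G u v → κ u ≡ κ v → Selects G f u v ⊎ Selects G f v u

  SelectsMonochromaticEdges⇒Colorable : ∀ f {m} (κ : Vertex G → Fin m) →
    SelectsMonochromaticEdges f κ → Colorable (removed G f) m
  SelectsMonochromaticEdges⇒Colorable f κ selects =
    κ , λ u v (adj , ¬selects-u , ¬selects-v) κu≡κv → [ ¬selects-u , ¬selects-v ]′ (selects u v adj κu≡κv)

  ∀HasClique∧Colorable⇒IsRobustCliqueNumber : ∀ {k} → (∀ f → HasClique (removed G f) k) →
    ∀ f → Colorable (removed G f) k → IsRobustCliqueNumber G k
  ∀HasClique∧Colorable⇒IsRobustCliqueNumber clique f col =
    (f , HasClique∧Colorable⇒IsCliqueNumber (removed G f) (clique f) col) ,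
    λ f′ m (_ , maximal) → maximal _ (clique f′)

  ∀HasClique∧Colorable⇒IsRobustChromaticNumber : ∀ {k} → (∀ f → HasClique (removed G f) k) →
    ∀ f → Colorable (removed G f) k → IsRobustChromaticNumber G k
  ∀HasClique∧Colorable⇒IsRobustChromaticNumber clique f col =
    (f , HasClique∧Colorable⇒IsChromaticNumber (removed G f) (clique f) col) ,
    λ f′ m (colₘ , _) → HasClique⇒≤ (removed G f′) (clique f′) colₘ

  IsRobustCliqueNumber∧IsRobustChromaticNumber⇒≤ : ∀ {w b} →
    IsRobustCliqueNumber G w → IsRobustChromaticNumber G b → w ≤ b
  IsRobustCliqueNumber∧IsRobustChromaticNumber⇒≤ {w} {b} (_ , minimal) ((f , colᵦ , _) , _) =
    decidable-stable (w ≤? b) (¬¬-cliqueNumber (removed G f) >>= λ where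
      (m , ω) → pure (≤-trans (minimal f m ω) (HasClique⇒≤ (removed G f) (proj₁ ω) colᵦ)))

  IsRobustChromaticNumber⇒≤ : ∀ {b k} → IsRobustChromaticNumber G b →
    DoubleNegation (Σ (OneSelection G) λ f → Colorable (removed G f) k) → b ≤ k
  IsRobustChromaticNumber⇒≤ {b} {k} (_ , minimal) ¬¬col =
    decidable-stable (b ≤? k) (¬¬col >>= λ (f , col) → ¬¬-chromaticNumber≤ (removed G f) col >>= λ where
      (m , χ , m≤k) → pure (≤-trans (minimal f m χ) m≤k))

  redirect : OneSelection G → (x y : Vertex G) → Adj G x y → OneSelection G
  redirect f x y x~y v with v Fin.≟ x
  ... | yes refl = just (y , x~y)
  ... | no _ = f v

module _ (G : Graph) (f : OneSelection G) where

  record CliqueSplit (L : List (Vertex G)) : Set where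
    field
      left right : List (Vertex G)
      left-clique : AllPairs (Adj (removed G f)) left
      right-clique : AllPairs (Adj (removed G f)) right
      length-sum : length left + length right ≡ length L
      left⊆L : left ⊆ L
      right⊆L : right ⊆ L
      disjoint : ∀ {z} → z ∈ left → z ∉ right

  selectsInto? : ∀ x ys → Dec (Σ (Vertex G) λ y → Selects G f x y × y ∈ ys)
  selectsInto? x ys with selTarget G f x
  ... | nothing = no λ ()
  ... | just y with Any.any? (y Fin.≟_) ys
  ...   | yes y∈ys = yes (y , refl , y∈ys)
  ...   | no y∉ys = no λ { (_ , refl , y∈ys) → y∉ys y∈ys }

  -- x joins the side not containing the vertex it selects; by hypothesis no vertex of xs selects x.
  cliqueSplit : ∀ {L} → AllPairs (Adj G) L → AllPairs (λ x y → ¬ Selects G f y x) L → CliqueSplit L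
  cliqueSplit {[]} _ _ = record
    { left = [] ; right = [] ; left-clique = [] ; right-clique = [] ; length-sum = refl
    ; left⊆L = λ () ; right⊆L = λ () ; disjoint = λ () }
  cliqueSplit {x ∷ xs} (x~xs ∷ adjs) (xs↛x ∷ unselected) = extend (selectsInto? x left)
    where
    open CliqueSplit (cliqueSplit adjs unselected)
    x∉xs : x ∉ xs
    x∉xs x∈xs = Graph.irrefl G (All.lookup x~xs x∈xs)
    edge : ∀ {z} → z ∈ xs → ¬ Selects G f x z → Adj (removed G f) x z
    edge z∈xs ¬x→z = All.lookup x~xs z∈xs , ¬x→z , All.lookup xs↛x z∈xs
    extend : Dec (Σ (Vertex G) λ y → Selects G f x y × y ∈ left) → CliqueSplit (x ∷ xs)
    extend (yes (y , x→y , y∈left)) = record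
      { left = left ; right = x ∷ right ; left-clique = left-clique
      ; right-clique = All.tabulate (λ {z} z∈right → edge (right⊆L z∈right)
          (λ x→z → disjoint y∈left (subst (_∈ right) (sym (just-injective (trans (sym x→y) x→z))) z∈right))) ∷ right-clique
      ; length-sum = trans (+-suc (length left) (length right)) (cong suc length-sum)
      ; left⊆L = there ∘ left⊆L ; right⊆L = λ { (here refl) → here refl ; (there z∈) → there (right⊆L z∈) }
      ; disjoint = λ { z∈left (here refl) → x∉xs (left⊆L z∈left) ; z∈left (there z∈right) → disjoint z∈left z∈right } }
    extend (no ¬x→left) = record
      { left = x ∷ left ; right = right
      ; left-clique = All.tabulate (λ {z} z∈left → edge (left⊆L z∈left) (λ x→z → ¬x→left (z , x→z , z∈left))) ∷ left-clique
      ; right-clique = right-clique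
      ; length-sum = cong suc length-sum
      ; left⊆L = λ { (here refl) → here refl ; (there z∈) → there (left⊆L z∈) } ; right⊆L = there ∘ right⊆L
      ; disjoint = λ { (here refl) z∈right → x∉xs (right⊆L z∈right) ; (there z∈left) z∈right → disjoint z∈left z∈right } }

  AllPairs⇒HasClique-⌈/2⌉ : ∀ {L} → AllPairs (Adj G) L → AllPairs (λ x y → ¬ Selects G f y x) L →
    HasClique (removed G f) ⌈ length L /2⌉
  AllPairs⇒HasClique-⌈/2⌉ {L} adjs unselected =
    [ HasClique-≤ (removed G f) (AllPairs⇒HasClique (removed G f) left-clique)
    , HasClique-≤ (removed G f) (AllPairs⇒HasClique (removed G f) right-clique) ]′
    (subst (λ m → ⌈ m /2⌉ ≤ length left ⊎ ⌈ m /2⌉ ≤ length right) length-sum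
      (⌈m+n/2⌉≤m⊎⌈m+n/2⌉≤n (length left) (length right)))
    where open CliqueSplit (cliqueSplit adjs unselected)

-- Induced paths and cycles

Consecutive : ∀ {m} → Fin m → Fin m → Set
Consecutive i j = toℕ j ≡ suc (toℕ i) ⊎ toℕ i ≡ suc (toℕ j)

module _ (G : Graph) where

  data InducedPath : List (Vertex G) → Set where
    [-]  : ∀ {x} → InducedPath (x ∷ [])
    cons : ∀ {x y ys} → x ∉ y ∷ ys → Adj G x y → All (¬_ ∘ Adj G x) ys →
           InducedPath (y ∷ ys) → InducedPath (x ∷ y ∷ ys)

  InducedPath-prefix : ∀ {x} xs {ys} → InducedPath (x ∷ xs ++ ys) → InducedPath (x ∷ xs)
  InducedPath-prefix [] _ = [-]
  InducedPath-prefix (_ ∷ xs) (cons x∉ x~y x≁ path) =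
    cons (x∉ ∘ ∈-++⁺ˡ) x~y (++⁻ˡ xs x≁) (InducedPath-prefix xs path)

  InducedPath-lookup-injective : ∀ {P} → InducedPath P → ∀ {i j} → lookup P i ≡ lookup P j → i ≡ j
  InducedPath-lookup-injective [-] {Fin.zero} {Fin.zero} _ = refl
  InducedPath-lookup-injective (cons _ _ _ _) {Fin.zero} {Fin.zero} _ = refl
  InducedPath-lookup-injective (cons x∉ _ _ _) {Fin.zero} {Fin.suc j} e = ⊥-elim (x∉ (subst (_∈ _) (sym e) (∈-lookup j)))
  InducedPath-lookup-injective (cons x∉ _ _ _) {Fin.suc i} {Fin.zero} e = ⊥-elim (x∉ (subst (_∈ _) e (∈-lookup i)))
  InducedPath-lookup-injective (cons _ _ _ path) {Fin.suc i} {Fin.suc j} e =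
    cong Fin.suc (InducedPath-lookup-injective path e)

  InducedPath⇒length≤ : ∀ {P} → InducedPath P → length P ≤ n G
  InducedPath⇒length≤ path = injective⇒≤ (InducedPath-lookup-injective path)

  Adj-lookup⇔≡0 : ∀ {x y ys} → Adj G x y → All (¬_ ∘ Adj G x) ys →
    ∀ j → Adj G x (lookup (y ∷ ys) j) ⇔′ (toℕ j ≡ 0)
  Adj-lookup⇔≡0 x~y _ Fin.zero = (λ _ → refl) , λ _ → x~y
  Adj-lookup⇔≡0 _ x≁ys (Fin.suc j) = (λ x~ → ⊥-elim (All.lookup x≁ys (∈-lookup j) x~)) , λ ()

  Adj-lookup⇔≡last : ∀ {x b} as → All (¬_ ∘ Adj G x) as → Adj G x b →
    ∀ j → Adj G x (lookup (as ++ b ∷ []) j) ⇔′ (suc (toℕ j) ≡ length (as ++ b ∷ []))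
  Adj-lookup⇔≡last [] _ x~b Fin.zero = (λ _ → refl) , λ _ → x~b
  Adj-lookup⇔≡last (_ ∷ as) (x≁a ∷ _) _ Fin.zero =
    (λ x~a → ⊥-elim (x≁a x~a)) , λ e → ⊥-elim (0≢1+n (trans (suc-injective e) (trans (length-++ as) (+-comm (length as) 1))))
  Adj-lookup⇔≡last (_ ∷ as) (_ ∷ x≁as) x~b (Fin.suc j) =
    (cong suc ∘ proj₁ (Adj-lookup⇔≡last as x≁as x~b j)) , (proj₂ (Adj-lookup⇔≡last as x≁as x~b j) ∘ suc-injective)

  adjacent-to-ends : ∀ {q p b} {as} → Adj G q p → All (¬_ ∘ Adj G q) as → Adj G q b →
    ∀ j → Adj G q (lookup (p ∷ as ++ b ∷ []) j) ⇔′ (toℕ j ≡ 0 ⊎ suc (toℕ j) ≡ length (p ∷ as ++ b ∷ []))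
  adjacent-to-ends q~p _ _ Fin.zero = (λ _ → inj₁ refl) , λ _ → q~p
  adjacent-to-ends {as = as} _ q≁as q~b (Fin.suc j) =
    (inj₂ ∘ cong suc ∘ proj₁ (Adj-lookup⇔≡last as q≁as q~b j)) ,
    λ { (inj₁ ()) ; (inj₂ e) → proj₂ (Adj-lookup⇔≡last as q≁as q~b j) (suc-injective e) }

  InducedPath⇒Adj⇔Consecutive : ∀ {P} → InducedPath P → ∀ i j → Adj G (lookup P i) (lookup P j) ⇔′ Consecutive i j
  InducedPath⇒Adj⇔Consecutive [-] Fin.zero Fin.zero = ⊥-elim ∘ Graph.irrefl G , λ { (inj₁ ()) ; (inj₂ ()) }
  InducedPath⇒Adj⇔Consecutive (cons _ _ _ _) Fin.zero Fin.zero = ⊥-elim ∘ Graph.irrefl G , λ { (inj₁ ()) ; (inj₂ ()) }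
  InducedPath⇒Adj⇔Consecutive (cons _ x~y x≁ _) Fin.zero (Fin.suc j) =
    (inj₁ ∘ cong suc ∘ proj₁ (Adj-lookup⇔≡0 x~y x≁ j)) ,
    λ { (inj₁ e) → proj₂ (Adj-lookup⇔≡0 x~y x≁ j) (suc-injective e) ; (inj₂ ()) }
  InducedPath⇒Adj⇔Consecutive (cons _ x~y x≁ _) (Fin.suc i) Fin.zero =
    (inj₂ ∘ cong suc ∘ proj₁ (Adj-lookup⇔≡0 x~y x≁ i) ∘ Graph.sym G) ,
    λ { (inj₁ ()) ; (inj₂ e) → Graph.sym G (proj₂ (Adj-lookup⇔≡0 x~y x≁ i) (suc-injective e)) }
  InducedPath⇒Adj⇔Consecutive (cons _ _ _ path) (Fin.suc i) (Fin.suc j) =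
    (Sum.map (cong suc) (cong suc) ∘ proj₁ (InducedPath⇒Adj⇔Consecutive path i j)) ,
    (proj₂ (InducedPath⇒Adj⇔Consecutive path i j) ∘ Sum.map suc-injective suc-injective)

  closeInducedCycle : ∀ {q P} → InducedPath P → q ∉ P → 3 ≤ length P →
    (∀ j → Adj G q (lookup P j) ⇔′ (toℕ j ≡ 0 ⊎ suc (toℕ j) ≡ length P)) →
    HasInducedCycle G (suc (length P))
  closeInducedCycle {q} {P} path q∉P 3≤|P| ends = lookup (q ∷ P) , injective , adjacency
    where
    injective : ∀ {i j} → lookup (q ∷ P) i ≡ lookup (q ∷ P) j → i ≡ j
    injective {Fin.zero} {Fin.zero} _ = refl
    injective {Fin.zero} {Fin.suc j} e = ⊥-elim (q∉P (subst (_∈ P) (sym e) (∈-lookup j)))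
    injective {Fin.suc i} {Fin.zero} e = ⊥-elim (q∉P (subst (_∈ P) e (∈-lookup i)))
    injective {Fin.suc i} {Fin.suc j} e = cong Fin.suc (InducedPath-lookup-injective path e)

    1≢1+|P| : 1 ≢ suc (length P)
    1≢1+|P| e = <⇒≢ (≤-trans (s≤s z≤n) 3≤|P|) (suc-injective e)

    adjacency : ∀ i j → Adj G (lookup (q ∷ P) i) (lookup (q ∷ P) j) ⇔′ CycleAdj (suc (length P)) i j
    adjacency Fin.zero Fin.zero = ⊥-elim ∘ Graph.irrefl G , λ where
      (inj₁ ())
      (inj₂ (inj₁ ()))
      (inj₂ (inj₂ (inj₁ (_ , e)))) → ⊥-elim (1≢1+|P| e)
      (inj₂ (inj₂ (inj₂ (_ , e)))) → ⊥-elim (1≢1+|P| e)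
    adjacency Fin.zero (Fin.suc j) =
      ([ inj₁ ∘ cong suc , (λ e → inj₂ (inj₂ (inj₁ (refl , cong suc e)))) ]′ ∘ proj₁ (ends j)) , λ where
        (inj₁ e) → proj₂ (ends j) (inj₁ (suc-injective e))
        (inj₂ (inj₁ ()))
        (inj₂ (inj₂ (inj₁ (_ , e)))) → proj₂ (ends j) (inj₂ (suc-injective e))
        (inj₂ (inj₂ (inj₂ (() , _))))
    adjacency (Fin.suc i) Fin.zero =
      ([ inj₂ ∘ inj₁ ∘ cong suc , (λ e → inj₂ (inj₂ (inj₂ (refl , cong suc e)))) ]′ ∘ proj₁ (ends i) ∘ Graph.sym G) , λ where
        (inj₁ ())
        (inj₂ (inj₁ e)) → Graph.sym G (proj₂ (ends i) (inj₁ (suc-injective e)))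
        (inj₂ (inj₂ (inj₁ (() , _))))
        (inj₂ (inj₂ (inj₂ (_ , e)))) → Graph.sym G (proj₂ (ends i) (inj₂ (suc-injective e)))
    adjacency (Fin.suc i) (Fin.suc j) =
      ([ inj₁ ∘ cong suc , inj₂ ∘ inj₁ ∘ cong suc ]′ ∘ proj₁ (InducedPath⇒Adj⇔Consecutive path i j)) , λ where
        (inj₁ e) → proj₂ (InducedPath⇒Adj⇔Consecutive path i j) (inj₁ (suc-injective e))
        (inj₂ (inj₁ e)) → proj₂ (InducedPath⇒Adj⇔Consecutive path i j) (inj₂ (suc-injective e))
        (inj₂ (inj₂ (inj₁ (() , _))))
        (inj₂ (inj₂ (inj₂ (() , _))))

-- Chordal graphs

1≤length-∷ʳ : ∀ {A : Set} (xs : List A) {y} → 1 ≤ length (xs ++ y ∷ [])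
1≤length-∷ʳ [] = s≤s z≤n
1≤length-∷ʳ (_ ∷ _) = s≤s z≤n

_without_ : ∀ {m} → List (Fin m) → Fin m → List (Fin m)
xs without x = filter (λ y → ¬? (y Fin.≟ x)) xs

without-shorter : ∀ {m} {x : Fin m} {xs} → x ∈ xs → length (xs without x) < length xs
without-shorter {x = x} {xs} x∈xs = filter-notAll (λ y → ¬? (y Fin.≟ x)) xs (Any.map (λ { refl x≢x → x≢x refl }) x∈xs)

∈-without : ∀ {m} {x y : Fin m} {xs} → y ∈ xs → y ≢ x → y ∈ xs without x
∈-without {x = x} = ∈-filter⁺ (λ y → ¬? (y Fin.≟ x))

¬¬-first : ∀ {A : Set} {P : A → Set} {xs} → Any P xs →
  DoubleNegation (Σ (List A) λ as → Σ A λ b → Σ (List A) λ bs → xs ≡ as ++ b ∷ bs × All (¬_ ∘ P) as × P b)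
¬¬-first (here px) = pure ([] , _ , _ , refl , [] , px)
¬¬-first {P = P} {x ∷ _} (there any) = ¬¬-excluded-middle {A = P x} >>= λ where
  (yes px) → pure ([] , x , _ , refl , [] , px)
  (no ¬px) → ¬¬-first any >>= λ where
    (as , b , bs , e , ¬as , pb) → pure (x ∷ as , b , bs , cong (x ∷_) e , ¬px ∷ ¬as , pb)

module MonochromaticForest (G : Graph) (chordal : Chordal G) {m} (κ : Vertex G → Fin m)
  (no-monochromatic-triangle : ∀ {u v w} → Adj G u v → Adj G v w → Adj G u w → κ u ≡ κ v → κ v ≡ κ w → ⊥) where

  Mono : Vertex G → Vertex G → Set
  Mono u v = Adj G u v × κ u ≡ κ v

  -- A chord from q into p₁ ∷ ps would close a monochromatic triangle (if it goes to p₁) or,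
  -- taking the first one, an induced cycle of length at least 4.
  ¬¬-InducedPath-∷ : ∀ {q p p₁ ps} → InducedPath G (p ∷ p₁ ∷ ps) → κ p ≡ κ p₁ → Mono p q → q ≢ p₁ →
    DoubleNegation (InducedPath G (q ∷ p ∷ p₁ ∷ ps))
  ¬¬-InducedPath-∷ {q} {p} {p₁} {ps} path@(cons _ p~p₁ p≁ps _) κp≡κp₁ (p~q , κp≡κq) q≢p₁ =
    ¬¬-excluded-middle {A = Any (Adj G q) (p₁ ∷ ps)} >>= λ where
      (no q≁) → pure (cons q∉ (Graph.sym G p~q) (¬Any⇒All¬ _ q≁) path)
      (yes chord) → ¬¬-first chord >>= λ (as , b , bs , e , q≁as , q~b) → ⊥-elim (first-chord as e q≁as q~b)
    where
    q∉ : q ∉ p ∷ p₁ ∷ ps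
    q∉ (here refl) = Graph.irrefl G p~q
    q∉ (there (here q≡p₁)) = q≢p₁ q≡p₁
    q∉ (there (there q∈ps)) = All.lookup p≁ps q∈ps p~q

    first-chord : ∀ as {b bs} → p₁ ∷ ps ≡ as ++ b ∷ bs → All (¬_ ∘ Adj G q) as → Adj G q b → ⊥
    first-chord [] refl _ q~p₁ =
      no-monochromatic-triangle (Graph.sym G p~q) p~p₁ q~p₁ (sym κp≡κq) κp≡κp₁
    first-chord (a ∷ as) {b} {bs} e q≁as q~b =
      chordal (suc (length cycle)) (s≤s 3≤|cycle|)
        (closeInducedCycle G prefix (q∉ ∘ ∈-cycle⇒∈path) 3≤|cycle|
          (adjacent-to-ends G (Graph.sym G p~q) q≁as q~b))
      where
      cycle = p ∷ a ∷ as ++ b ∷ []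
      path≡ : p ∷ p₁ ∷ ps ≡ cycle ++ bs
      path≡ = cong (p ∷_) (trans e (sym (++-assoc (a ∷ as) (b ∷ []) bs)))
      prefix : InducedPath G cycle
      prefix = InducedPath-prefix G (a ∷ as ++ b ∷ []) (subst (InducedPath G) path≡ path)
      3≤|cycle| : 3 ≤ length cycle
      3≤|cycle| = s≤s (s≤s (1≤length-∷ʳ as))
      ∈-cycle⇒∈path : ∀ {x} → x ∈ cycle → x ∈ p ∷ p₁ ∷ ps
      ∈-cycle⇒∈path {x} x∈ = subst (x ∈_) (sym path≡) (∈-++⁺ˡ x∈)

  IsLeaf : List (Vertex G) → Vertex G → Set
  IsLeaf S x = ∀ {y z} → y ∈ S → z ∈ S → Mono x y → Mono x z → y ≡ z

  module _ (S : List (Vertex G)) (no-leaf : ∀ {x} → x ∈ S → ¬ IsLeaf S x) where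

    TwoNeighbours : Vertex G → Set
    TwoNeighbours x = Σ (Vertex G) λ y → Σ (Vertex G) λ z → y ∈ S × z ∈ S × Mono x y × Mono x z × y ≢ z

    ¬¬-twoNeighbours : ∀ {x} → x ∈ S → DoubleNegation (TwoNeighbours x)
    ¬¬-twoNeighbours {x} x∈S = ¬¬-excluded-middle {A = TwoNeighbours x} >>= λ where
      (yes two) → pure two
      (no ¬two) → ⊥-elim (no-leaf x∈S λ {y} {z} y∈S z∈S x-y x-z →
        decidable-stable (y Fin.≟ z) λ y≢z → ¬two (y , z , y∈S , z∈S , x-y , x-z , y≢z))

    MonoPath : Fin m → List (Vertex G) → Set
    MonoPath c P = All (λ x → x ∈ S × κ x ≡ c) P × InducedPath G P

    ¬¬-extend : ∀ {c p ps} → MonoPath c (p ∷ ps) → DoubleNegation (Σ (Vertex G) λ q → MonoPath c (q ∷ p ∷ ps))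
    ¬¬-extend ((p∈S , κp≡c) ∷ [] , [-]) = ¬¬-twoNeighbours p∈S >>= λ where
      (q , _ , q∈S , _ , (p~q , κp≡κq) , _ , _) →
        pure (q , (q∈S , trans (sym κp≡κq) κp≡c) ∷ (p∈S , κp≡c) ∷ [] ,
              cons (λ { (here refl) → Graph.irrefl G p~q }) (Graph.sym G p~q) [] [-])
    ¬¬-extend {ps = p₁ ∷ _} (inS@((p∈S , κp≡c) ∷ (_ , κp₁≡c) ∷ _) , path@(cons _ _ _ _)) =
      ¬¬-twoNeighbours p∈S >>= λ (y , z , y∈S , z∈S , p-y , p-z , y≢z) →
      let (q , q∈S , p-q , q≢p₁) = other-than p₁ y∈S z∈S p-y p-z y≢z in
      ¬¬-InducedPath-∷ path (trans κp≡c (sym κp₁≡c)) p-q q≢p₁ >>= λ path′ →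
      pure (q , (q∈S , trans (sym (proj₂ p-q)) κp≡c) ∷ inS , path′)
      where
      other-than : ∀ {p} x {y z} → y ∈ S → z ∈ S → Mono p y → Mono p z → y ≢ z →
                   Σ (Vertex G) λ q → q ∈ S × Mono p q × q ≢ x
      other-than x {y} {z} y∈S z∈S p-y p-z y≢z with y Fin.≟ x
      ... | no y≢x = y , y∈S , p-y , y≢x
      ... | yes refl = z , z∈S , p-z , y≢z ∘ sym

    ¬¬-longMonoPath : ∀ {x} → x ∈ S → ∀ L → DoubleNegation (Σ (List (Vertex G)) λ P → MonoPath (κ x) P × length P ≡ suc L)
    ¬¬-longMonoPath {x} x∈S zero = pure (x ∷ [] , ((x∈S , refl) ∷ [] , [-]) , refl)
    ¬¬-longMonoPath x∈S (suc L) = ¬¬-longMonoPath x∈S L >>= λ where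
      (p ∷ ps , mono-path , |P|≡) → ¬¬-extend mono-path >>= λ where
        (q , mono-path′) → pure (q ∷ p ∷ ps , mono-path′ , cong suc |P|≡)

  ¬¬-leaf : ∀ S {x} → x ∈ S → DoubleNegation (Σ (Vertex G) λ y → y ∈ S × IsLeaf S y)
  ¬¬-leaf S x∈S ¬leaf =
    ¬¬-longMonoPath S (λ y∈S leaf → ¬leaf (_ , y∈S , leaf)) x∈S (n G) λ where
      (P , (_ , path) , |P|≡1+n) → 1+n≰n (subst (_≤ n G) |P|≡1+n (InducedPath⇒length≤ G path))

  Covers : List (Vertex G) → OneSelection G → Set
  Covers S f = ∀ u v → u ∈ S → v ∈ S → Mono u v → Selects G f u v ⊎ Selects G f v u

  Covers-isolated : ∀ {S x g} → Covers (S without x) g → ¬ (Σ (Vertex G) λ y → y ∈ S × Mono x y) → Covers S g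
  Covers-isolated {x = x} covers isolated u v u∈S v∈S u-v with u Fin.≟ x | v Fin.≟ x
  ... | yes refl | _ = ⊥-elim (isolated (v , v∈S , u-v))
  ... | no _ | yes refl = ⊥-elim (isolated (u , u∈S , Graph.sym G (proj₁ u-v) , sym (proj₂ u-v)))
  ... | no u≢x | no v≢x = covers u v (∈-without u∈S u≢x) (∈-without v∈S v≢x) u-v

  Covers-leaf : ∀ {S x y g} → IsLeaf S x → Covers (S without x) g → y ∈ S → (x-y : Mono x y) →
    Covers S (redirect G g x y (proj₁ x-y))
  -- In the cases u ≡ x and v ≡ x the goal computes to just y ≡ just _, as redirect branches on the same test.
  Covers-leaf {x = x} leaf covers y∈S x-y u v u∈S v∈S u-v with u Fin.≟ x | v Fin.≟ x
  ... | yes refl | _ = inj₁ (cong just (leaf y∈S v∈S x-y u-v))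
  ... | no _ | yes refl = inj₂ (cong just (leaf y∈S u∈S x-y (Graph.sym G (proj₁ u-v) , sym (proj₂ u-v))))
  ... | no u≢x | no v≢x = covers u v (∈-without u∈S u≢x) (∈-without v∈S v≢x) u-v

  ¬¬-covering : ∀ S → DoubleNegation (Σ (OneSelection G) (Covers S))
  ¬¬-covering S = bounded (length S) S ≤-refl
    where
    bounded : ∀ N S → length S ≤ N → DoubleNegation (Σ (OneSelection G) (Covers S))
    bounded _ [] _ = pure ((λ _ → nothing) , λ _ _ ())
    bounded (suc N) S@(_ ∷ _) |S|≤1+N = ¬¬-leaf S (here refl) >>= λ (x , x∈S , leaf) →
      bounded N (S without x) (s≤s⁻¹ (≤-trans (without-shorter x∈S) |S|≤1+N)) >>= λ (g , covers) →
      ¬¬-excluded-middle {A = Σ (Vertex G) λ y → y ∈ S × Mono x y} >>= λ where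
        (yes (y , y∈S , x-y)) → pure (redirect G g x y (proj₁ x-y) , Covers-leaf leaf covers y∈S x-y)
        (no isolated) → pure (g , Covers-isolated {S} {x} {g} covers isolated)

  ¬¬-selectsMonochromaticEdges : DoubleNegation (Σ (OneSelection G) λ f → SelectsMonochromaticEdges G f κ)
  ¬¬-selectsMonochromaticEdges = ¬¬-covering (allFin (n G)) >>= λ where
    (f , covers) → pure (f , λ u v u~v κu≡κv → covers u v (∈-allFin u) (∈-allFin v) (u~v , κu≡κv))

Chordal⇒¬¬-halvingSelection : ∀ G → Chordal G → ∀ {c} → Colorable G c →
  DoubleNegation (Σ (OneSelection G) λ f → Colorable (removed G f) ⌈ c /2⌉)
Chordal⇒¬¬-halvingSelection G chordal (col , proper) =
  ¬¬-selectsMonochromaticEdges >>= λ (f , selects) →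
  pure (f , SelectsMonochromaticEdges⇒Colorable G f (halve ∘ col) selects)
  where
  open MonochromaticForest G chordal (halve ∘ col) (λ u~v v~w u~w same₁ same₂ →
    halve-noThreeDistinct same₁ same₂ (proper _ _ u~v) (proper _ _ v~w) (proper _ _ u~w))

-- Dyadic interval graphs

reach : ℕ → ℕ
reach zero = zero
reach (suc h) = suc (reach h + reach h)

width : ℕ → ℕ
width h = suc (reach h)

-- [lo h j , hi h j] is the dyadic interval [j 2^h , (j + 1) 2^h - 1].
lo hi : ℕ → ℕ → ℕ
lo h j = j * width h
hi h j = lo h j + reach h

lo≤hi : ∀ h j → lo h j ≤ hi h j
lo≤hi h j = m≤m+n (lo h j) (reach h)

n≤lo : ∀ h j → j ≤ lo h j
n≤lo h j = m≤m*n j (width h)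

lo-mono : ∀ h {j j′} → j ≤ j′ → lo h j ≤ lo h j′
lo-mono h = *-monoˡ-≤ (width h)

hi-mono : ∀ h {j j′} → j ≤ j′ → hi h j ≤ hi h j′
hi-mono h = +-monoˡ-≤ (reach h) ∘ lo-mono h

hi<lo : ∀ h {j j′} → j < j′ → hi h j < lo h j′
hi<lo h {j} {j′} j<j′ = begin-strict
  lo h j + reach h <⟨ +-monoʳ-< (lo h j) (n<1+n (reach h)) ⟩
  lo h j + width h ≡⟨ +-comm (lo h j) (width h) ⟩
  lo h (suc j)     ≤⟨ lo-mono h j<j′ ⟩
  lo h j′          ∎
  where open ≤-Reasoning

lo-suc : ∀ h b → lo (suc h) b ≡ lo h (b + b)
lo-suc h b = identity b (reach h)
  where
  identity : ∀ b r → b * suc (suc (r + r)) ≡ (b + b) * suc r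
  identity = solve-∀

hi-suc : ∀ h b → hi (suc h) b ≡ hi h (suc (b + b))
hi-suc h b = identity b (reach h)
  where
  identity : ∀ b r → b * suc (suc (r + r)) + suc (r + r) ≡ suc (b + b) * suc r + r
  identity = solve-∀

lo-⌊/2⌋ : ∀ h a → lo (suc h) ⌊ a /2⌋ ≤ lo h a
lo-⌊/2⌋ h a = ≤-trans (≤-reflexive (lo-suc h ⌊ a /2⌋)) (lo-mono h (⌊n/2⌋+⌊n/2⌋≤n a))

hi-⌊/2⌋ : ∀ h a → hi h a ≤ hi (suc h) ⌊ a /2⌋
hi-⌊/2⌋ h a = ≤-trans (hi-mono h (n≤1+⌊n/2⌋+⌊n/2⌋ a)) (≤-reflexive (sym (hi-suc h ⌊ a /2⌋)))

intersecting⇒⌊/2⌋≡ : ∀ h a b → lo h a ≤ hi (suc h) b → lo (suc h) b ≤ hi h a → ⌊ a /2⌋ ≡ b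
intersecting⇒⌊/2⌋≡ h a b lo≤hi′ lo′≤hi = ≤-antisym
  (≤-trans (⌊n/2⌋-mono a≤1+2b) (≤-reflexive (sym (n≡⌈n+n/2⌉ b))))
  (≤-trans (≤-reflexive (n≡⌊n+n/2⌋ b)) (⌊n/2⌋-mono 2b≤a))
  where
  a≤1+2b : a ≤ suc (b + b)
  a≤1+2b = ≮⇒≥ λ 1+2b<a → <⇒≱ (hi<lo h 1+2b<a) (subst (lo h a ≤_) (hi-suc h b) lo≤hi′)
  2b≤a : b + b ≤ a
  2b≤a = ≮⇒≥ λ a<2b → <⇒≱ (hi<lo h a<2b) (subst (_≤ hi h a) (lo-suc h b) lo′≤hi)

module DyadicTree (top : ℕ) where

  levels positions : ℕ
  levels = suc top
  positions = width top

  -- Vertex (h , j) is the interval [lo h j , hi h j]; every level gets width top positions, more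
  -- than the root's interval needs at lower levels, which does no harm.
  V : Set
  V = Fin (levels * positions)

  levelF : V → Fin levels
  levelF = quotient positions

  level position left right : V → ℕ
  level v = toℕ (levelF v)
  position v = toℕ (remainder {levels} positions v)
  left v = lo (level v) (position v)
  right v = hi (level v) (position v)

  G : Graph
  G = record
    { n = levels * positions
    ; Adj = λ u v → u ≢ v × left u ≤ right v × left v ≤ right u
    ; sym = λ (u≢v , l≤r , l≤r′) → u≢v ∘ sym , l≤r′ , l≤r
    ; irrefl = λ (v≢v , _) → v≢v refl
    }

  isInterval : IsIntervalGraph G
  isInterval = left , right , (λ v → lo≤hi (level v) (position v)) ,
    λ u v u≢v → (λ (_ , l≤r , l≤r′) → l≤r , l≤r′) , (λ (l≤r , l≤r′) → u≢v , l≤r , l≤r′)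

  vertex : ∀ {h j} → h < levels → j < positions → V
  vertex h<levels j<positions = combine (fromℕ< h<levels) (fromℕ< j<positions)

  level-vertex : ∀ {h j} (h< : h < levels) (j< : j < positions) → level (vertex h< j<) ≡ h
  level-vertex h< j< =
    trans (cong (toℕ ∘ proj₁) (remQuot-combine {k = positions} (fromℕ< h<) (fromℕ< j<))) (toℕ-fromℕ< h<)

  position-vertex : ∀ {h j} (h< : h < levels) (j< : j < positions) → position (vertex h< j<) ≡ j
  position-vertex h< j< =
    trans (cong (toℕ ∘ proj₂) (remQuot-combine {k = positions} (fromℕ< h<) (fromℕ< j<))) (toℕ-fromℕ< j<)

  vertex-unique : ∀ {u v} → level u ≡ level v → position u ≡ position v → u ≡ v
  vertex-unique {u} {v} level≡ position≡ = begin
    u                                                   ≡⟨ combine-remQuot {levels} positions u ⟨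
    combine (levelF u) (remainder {levels} positions u) ≡⟨ cong₂ combine (toℕ-injective level≡) (toℕ-injective position≡) ⟩
    combine (levelF v) (remainder {levels} positions v) ≡⟨ combine-remQuot {levels} positions v ⟩
    v                                                   ∎
    where open ≡-Reasoning

  left-vertex : ∀ {h j} (h< : h < levels) (j< : j < positions) → left (vertex h< j<) ≡ lo h j
  left-vertex h< j< = cong₂ lo (level-vertex h< j<) (position-vertex h< j<)

  right-vertex : ∀ {h j} (h< : h < levels) (j< : j < positions) → right (vertex h< j<) ≡ hi h j
  right-vertex h< j< = cong₂ hi (level-vertex h< j<) (position-vertex h< j<)

  same-level⇒¬Adj : ∀ {u v} → level u ≡ level v → ¬ Adj G u v
  same-level⇒¬Adj {u} {v} level≡ (u≢v , lu≤rv , lv≤ru) with <-cmp (position u) (position v)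
  ... | tri< pu<pv _ _ = <⇒≱ (subst (λ h → hi (level u) (position u) < lo h (position v)) level≡ (hi<lo (level u) pu<pv)) lv≤ru
  ... | tri≈ _ pu≡pv _ = u≢v (vertex-unique level≡ pu≡pv)
  ... | tri> _ _ pv<pu = <⇒≱ (subst (λ h → hi h (position v) < lo (level u) (position u)) level≡ (hi<lo (level u) pv<pu)) lu≤rv

  levelColouring : Colorable G levels
  levelColouring = levelF , λ u v u~v levelF≡ → same-level⇒¬Adj (cong toℕ levelF≡) u~v

  columnClique : HasClique G levels
  columnClique = column , column-injective , λ i j i≢j → (i≢j ∘ column-injective) , leftmost i j , leftmost j i
    where
    column : Fin levels → V
    column i = vertex (toℕ<n i) (s≤s z≤n)
    column-injective : ∀ {i j} → column i ≡ column j → i ≡ j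
    column-injective {i} {j} e = toℕ-injective
      (trans (sym (level-vertex (toℕ<n i) (s≤s z≤n))) (trans (cong level e) (level-vertex (toℕ<n j) (s≤s z≤n))))
    leftmost : ∀ i j → left (column i) ≤ right (column j)
    leftmost i j = subst (_≤ right (column j)) (sym (left-vertex (toℕ<n i) (s≤s z≤n))) z≤n

  _⊑_ : V → V → Set
  u ⊑ v = left v ≤ left u × right u ≤ right v

  ⊑-refl : ∀ {v} → v ⊑ v
  ⊑-refl = ≤-refl , ≤-refl

  ⊑-trans : ∀ {u v w} → u ⊑ v → v ⊑ w → u ⊑ w
  ⊑-trans (lv≤lu , ru≤rv) (lw≤lv , rv≤rw) = ≤-trans lw≤lv lv≤lu , ≤-trans ru≤rv rv≤rw

  ⊑∧level<⇒Adj : ∀ {u v} → u ⊑ v → level u < level v → Adj G u v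
  ⊑∧level<⇒Adj {u} (lv≤lu , ru≤rv) lu<lv =
    (λ { refl → <-irrefl refl lu<lv }) ,
    ≤-trans (lo≤hi (level u) (position u)) ru≤rv , ≤-trans lv≤lu (lo≤hi (level u) (position u))

  ⌊position/2⌋<positions : ∀ v → ⌊ position v /2⌋ < positions
  ⌊position/2⌋<positions v = ≤-<-trans (⌊n/2⌋≤n (position v)) (toℕ<n (remainder {levels} positions v))

  parent : (v : V) → suc (level v) < levels → V
  parent v p = vertex p (⌊position/2⌋<positions v)

  ⊑-parent : ∀ v p → v ⊑ parent v p
  ⊑-parent v p =
    subst (_≤ left v) (sym (left-vertex p (⌊position/2⌋<positions v))) (lo-⌊/2⌋ (level v) (position v)) ,
    subst (right v ≤_) (sym (right-vertex p (⌊position/2⌋<positions v))) (hi-⌊/2⌋ (level v) (position v))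

  Adj-parent : ∀ v p → Adj G v (parent v p)
  Adj-parent v p = ⊑∧level<⇒Adj (⊑-parent v p)
    (subst (level v <_) (sym (level-vertex p (⌊position/2⌋<positions v))) (n<1+n (level v)))

  Adj⇒parent : ∀ {u v} → level u ≡ suc (level v) → Adj G u v → Σ (suc (level v) < levels) λ p → u ≡ parent v p
  Adj⇒parent {u} {v} level≡ (_ , lu≤rv , lv≤ru) = p , vertex-unique
    (trans level≡ (sym (level-vertex p (⌊position/2⌋<positions v))))
    (trans position≡ (sym (position-vertex p (⌊position/2⌋<positions v))))
    where
    p : suc (level v) < levels
    p = subst (_< levels) level≡ (toℕ<n (levelF u))
    position≡ : position u ≡ ⌊ position v /2⌋
    position≡ = sym (intersecting⇒⌊/2⌋≡ (level v) (position v) (position u)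
      (subst (λ h → lo (level v) (position v) ≤ hi h (position u)) level≡ lv≤ru)
      (subst (λ h → lo h (position u) ≤ hi (level v) (position v)) level≡ lu≤rv))

  parentSelection : OneSelection G
  parentSelection v with suc (level v) <? levels
  ... | yes p = just (parent v p , Adj-parent v p)
  ... | no _ = nothing

  parentSelection-selects : ∀ v p → Selects G parentSelection v (parent v p)
  parentSelection-selects v p with suc (level v) <? levels
  ... | yes _ = refl
  ... | no ¬p = ⊥-elim (¬p p)

  parentSelection-monochromatic : SelectsMonochromaticEdges G parentSelection (halve ∘ levelF)
  parentSelection-monochromatic u v u~v same-half with halve-≡⇒ same-half
  ... | inj₁ level≡ = ⊥-elim (same-level⇒¬Adj level≡ u~v)
  ... | inj₂ (inj₁ level≡) with Adj⇒parent level≡ u~v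
  ...   | p , refl = inj₂ (parentSelection-selects v p)
  parentSelection-monochromatic u v u~v same-half | inj₂ (inj₂ level≡) with Adj⇒parent level≡ (Graph.sym G u~v)
  ...   | p , refl = inj₁ (parentSelection-selects u p)

  record Children (cur : V) (h : ℕ) : Set where
    field
      child₀ child₁ : V
      level₀ : level child₀ ≡ h
      level₁ : level child₁ ≡ h
      child₀⊑ : child₀ ⊑ cur
      child₁⊑ : child₁ ⊑ cur
      children-disjoint : ∀ {z} → z ⊑ child₀ → z ⊑ child₁ → ⊥

  -- right cur ≤ reach top keeps the children's positions in range.
  children : ∀ cur {h} → level cur ≡ suc h → right cur ≤ reach top → Children cur h
  children cur {h} level≡ bound = record
    { child₀ = child 2b≤1+2b ; child₁ = child ≤-refl
    ; level₀ = level-vertex h< (in-range 2b≤1+2b) ; level₁ = level-vertex h< (in-range ≤-refl)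
    ; child₀⊑ = child⊑ 2b≤1+2b ≤-refl ; child₁⊑ = child⊑ ≤-refl 2b≤1+2b
    ; children-disjoint = λ {z} (_ , rz≤r₀) (l₁≤lz , _) → <⇒≱
        (subst₂ _<_ (sym (right-vertex h< (in-range 2b≤1+2b))) (sym (left-vertex h< (in-range ≤-refl)))
          (hi<lo h (n<1+n (b + b))))
        (≤-trans l₁≤lz (≤-trans (lo≤hi (level z) (position z)) rz≤r₀))
    }
    where
    b = position cur
    2b≤1+2b = n≤1+n (b + b)
    h< : h < levels
    h< = <-trans (n<1+n h) (subst (_< levels) level≡ (toℕ<n (levelF cur)))
    left-cur : left cur ≡ lo h (b + b)
    left-cur = trans (cong (λ l → lo l b) level≡) (lo-suc h b)
    right-cur : right cur ≡ hi h (suc (b + b))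
    right-cur = trans (cong (λ l → hi l b) level≡) (hi-suc h b)
    in-range : ∀ {j} → j ≤ suc (b + b) → j < positions
    in-range {j} j≤ = s≤s (≤-trans (n≤lo h j) (≤-trans (lo≤hi h j)
      (≤-trans (hi-mono h j≤) (≤-trans (≤-reflexive (sym right-cur)) bound))))
    child : ∀ {j} → j ≤ suc (b + b) → V
    child j≤ = vertex h< (in-range j≤)
    child⊑ : ∀ {j} (j≤ : j ≤ suc (b + b)) → b + b ≤ j → child j≤ ⊑ cur
    child⊑ j≤ 2b≤j =
      subst₂ _≤_ (sym left-cur) (sym (left-vertex h< (in-range j≤))) (lo-mono h 2b≤j) ,
      subst₂ _≤_ (sym (right-vertex h< (in-range j≤))) (sym right-cur) (hi-mono h j≤)

  module _ (f : OneSelection G) where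

    Below : V → V → Set
    Below x y = x ⊑ y × level x < level y × (∀ {z} → Selects G f y z → ¬ z ⊑ x)

    Below-trans : ∀ {x y z} → Below x y → Below y z → Below x z
    Below-trans {x} {y} {z} (x⊑y , lx<ly , _) (y⊑z , ly<lz , z-avoids-y) =
      ⊑-trans {x} {y} {z} x⊑y y⊑z , <-trans lx<ly ly<lz ,
      λ {w} z→w w⊑x → z-avoids-y z→w (⊑-trans {w} {x} {y} w⊑x x⊑y)

    -- The children are disjoint, so at most one of them contains the vertex that cur selects.
    child-avoiding : ∀ cur {h} → level cur ≡ suc h → right cur ≤ reach top → Σ V λ c → level c ≡ h × Below c cur
    child-avoiding cur {h} level≡ bound = pick (selTarget G f cur) refl
      where
      open Children (children cur level≡ bound)
      below : ∀ {c} → level c ≡ h → c ⊑ cur → (∀ {z} → Selects G f cur z → ¬ z ⊑ c) → level c ≡ h × Below c cur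
      below level-c c⊑cur avoids = level-c , c⊑cur , subst₂ _<_ (sym level-c) (sym level≡) (n<1+n h) , avoids
      selected≡ : ∀ {y z} → selTarget G f cur ≡ just y → Selects G f cur z → y ≡ z
      selected≡ sel≡ cur→z = just-injective (trans (sym sel≡) cur→z)
      pick : (s : Maybe V) → selTarget G f cur ≡ s → Σ V λ c → level c ≡ h × Below c cur
      pick nothing sel≡ = child₀ , below {child₀} level₀ child₀⊑ λ cur→z _ → case trans (sym sel≡) cur→z of λ ()
      pick (just y) sel≡ = choose ((left child₀ ≤? left y) ×-dec (right y ≤? right child₀))
        where
        choose : Dec (y ⊑ child₀) → Σ V λ c → level c ≡ h × Below c cur
        choose (yes y⊑child₀) = child₁ , below {child₁} level₁ child₁⊑ λ {z} cur→z z⊑child₁ →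
          children-disjoint {z} (subst (_⊑ child₀) (selected≡ sel≡ cur→z) y⊑child₀) z⊑child₁
        choose (no y⋢child₀) = child₀ , below {child₀} level₀ child₀⊑ λ {z} cur→z z⊑child₀ →
          y⋢child₀ (subst (_⊑ child₀) (sym (selected≡ sel≡ cur→z)) z⊑child₀)

    descend : ∀ h cur acc → level cur ≡ h → right cur ≤ reach top → AllPairs Below (cur ∷ acc) →
      Σ (List V) λ L → length L ≡ suc h + length acc × AllPairs Below L
    descend zero cur acc _ _ chain = cur ∷ acc , refl , chain
    descend (suc h) cur acc level≡ bound chain@(cur-below ∷ _) =
      let (c , level-c , c-below) = child-avoiding cur level≡ bound
          (L , |L|≡ , chain′) = descend h c (cur ∷ acc) level-c (≤-trans (proj₂ (proj₁ c-below)) bound)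
            ((c-below ∷ All.map (Below-trans {c} {cur} c-below) cur-below) ∷ chain)
      in L , trans |L|≡ (+-suc (suc h) (length acc)) , chain′

    robustClique : HasClique (removed G f) ⌈ levels /2⌉
    robustClique =
      let (L , |L|≡ , chain) = descend top root [] (level-vertex top<levels 0<positions)
                                 (≤-reflexive (right-vertex top<levels 0<positions)) ([] ∷ [])
      in subst (λ m → HasClique (removed G f) ⌈ m /2⌉) (trans |L|≡ (+-identityʳ levels))
           (AllPairs⇒HasClique-⌈/2⌉ G f
             (AllPairs.map (λ {x} {y} (x⊑y , lx<ly , _) → ⊑∧level<⇒Adj {x} {y} x⊑y lx<ly) chain)
             (AllPairs.map (λ {x} (_ , _ , y-avoids-x) y→x → y-avoids-x y→x (⊑-refl {x})) chain))
      where
      top<levels : top < levels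
      top<levels = n<1+n top
      0<positions : 0 < positions
      0<positions = s≤s z≤n
      root = vertex top<levels 0<positions

Chordal⇒robust-bounds : (G : Graph) → Chordal G → ∀ {w b c} → IsRobustCliqueNumber G w → IsRobustChromaticNumber G b →
  IsChromaticNumber G c → w ≤ b × b ≤ ⌈ c /2⌉
Chordal⇒robust-bounds G chordal ω₁ χ₁ (col , _) =
  IsRobustCliqueNumber∧IsRobustChromaticNumber⇒≤ G ω₁ χ₁ ,
  IsRobustChromaticNumber⇒≤ G χ₁ (Chordal⇒¬¬-halvingSelection G chordal col)

dyadicIntervalGraph : ∀ top → let k = suc top in Σ Graph λ G → IsIntervalGraph G ×
  IsCliqueNumber G k × IsChromaticNumber G k × IsRobustCliqueNumber G ⌈ k /2⌉ × IsRobustChromaticNumber G ⌈ k /2⌉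
dyadicIntervalGraph top =
  G , isInterval ,
  HasClique∧Colorable⇒IsCliqueNumber G columnClique levelColouring ,
  HasClique∧Colorable⇒IsChromaticNumber G columnClique levelColouring ,
  ∀HasClique∧Colorable⇒IsRobustCliqueNumber G robustClique parentSelection halvedColouring ,
  ∀HasClique∧Colorable⇒IsRobustChromaticNumber G robustClique parentSelection halvedColouring
  where
  open DyadicTree top
  halvedColouring : Colorable (removed G parentSelection) ⌈ levels /2⌉
  halvedColouring = SelectsMonochromaticEdges⇒Colorable G parentSelection (halve ∘ levelF) parentSelection-monochromatic

theorem1p2 : ((G : Graph) → Chordal G → (w b c : ℕ) → IsRobustCliqueNumber G w → IsRobustChromaticNumber G b → IsChromaticNumber G c → (w ≤ b × b ≤ ⌈ c /2⌉))
    × ((k : ℕ) → 2 ≤ k → Σ Graph λ G → IsIntervalGraph G × IsCliqueNumber G k × IsChromaticNumber G k × IsRobustCliqueNumber G ⌈ k /2⌉ × IsRobustChromaticNumber G ⌈ k /2⌉)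
theorem1p2 =
  (λ G chordal _ _ _ → Chordal⇒robust-bounds G chordal) ,
  λ { (suc top) _ → dyadicIntervalGraph top }
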